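{- Let $n\ge2$, $\mu=\lambda+(n-1,\dots,1,0)$ for a partition $\lambda$ with $\lambda_n=0$, and let $T\in F(\mu,n)$ have columns $C_1,\dots,C_m$. Fix $2\le i\le m$, let $T'$ be the columns $C_{i+1},\dots,C_m$, and let $\widehat{C}=\widehat{C}(S,C_i)$ where $S$ is the set of entries of $C_{i-1}$. If $\widehat{C}C_i$ satisfies the Non-overlapping Condition, then \[ \mathrm{inv}(\widehat{C}C_iT')=\mathrm{inv}(C_iT')+\hat{N}(i), \] where $XC_iT'$ denotes the filling whose columns are $X,C_i,\dots,C_m$ and $C_iT'$ the filling with columns $C_i,\dots,C_m$.
   Context: Cells $(i,j)$: row, column; cells attack if in the same column, or $u=(i,j),v=(k,j+1)$ with $i>k$. $F(\mu,n)$: fillings of $\mu$ with values in $[n]$, distinct values on attacking cells, weakly increasing rows. $\mathrm{inv}$ of a filling of a partition shape = number of pairs of cells $u=(j,k)$, $v=(i,k+1)$, $i<j$, with $\sigma(u)<\sigma(v)$ and, if $w=(j,k+1)$ is a cell, $\sigma(v)<\sigma(w)$. Hat construction for a column $C'$ of length $c'$ and a set $S$ of size $c\in\{c',c'+1\}$: process elements of $S$ in decreasing order; an element occurring in $C'$ goes in its row of $C'$; an element not in $C'$ goes, if $c=c'+1$ and row $c'+1$ is empty, in row $c'+1$, else in the row of the largest entry of $C'$ whose row in the left column is still empty. Pivots of $(\widehat{C},C_i)$: row $q$ with $q\le |C_i|$ and $\widehat{C}(q)<C_i(q)$, or $q=|C_i|+1\le|\widehat{C}|$; $b_q=\widehat{C}(q)$,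 $d_q=C_i(q)$ or $\infty$. Non-overlapping Condition: at most one pivot, or intervals $[b_q,d_q]$ for distinct pivots pairwise disjoint. $\hat{N}(i)=\sum_{q\text{ pivot}}\#\{x:\ x\text{ an entry of }C_i\text{ in a row strictly above }q,\ x\text{ occurs in }\widehat{C},\ b_q<x<d_q\}$. -}

module Defs where

open import Data.Nat using (ℕ; zero; suc; _+_; _∸_; _≤_; _<_; _⊔_; _≡ᵇ_; _<ᵇ_; _≤ᵇ_)
open import Data.Bool using (Bool; true; false; if_then_else_; _∧_)
open import Data.List using (List; []; _∷_; length; map; foldr; foldl; filterᵇ; upTo; downFrom; zip; zipWith; replicate; take)
open import Data.Nat.ListAction using (sum)
open import Data.Bool.ListAction using (any)
open import Data.Maybe using (Maybe; just; nothing; fromMaybe; _>>=_) renaming (map to mapMaybe)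
open import Data.Product using (_×_; _,_; proj₁; Σ)
open import Data.Sum using (_⊎_)
open import Data.Empty using (⊥)
open import Relation.Nullary using (¬_)
open import Relation.Binary.PropositionalEquality using (_≡_; _≢_)
open import Data.List.Relation.Unary.AllPairs using (AllPairs)

-- Conventions.  A filling is a list of columns (left to right); a column
-- is the list of its entries from row 1 (top) downwards.  Internally all
-- row / column indices below are 0-based.

_!?_ : {A : Set} → List A → ℕ → Maybe A
[] !? _ = nothing
(x ∷ xs) !? zero = just x
(x ∷ xs) !? suc k = xs !? k

ent : List (List ℕ) → ℕ → ℕ → Maybe ℕ
ent T r j = (T !? j) >>= λ C → C !? r

-- λ given as (λ_1,…,λ_n) : a partition with at most n parts, padded by
-- zeros; λ_n = 0.
IsPartitionN : ℕ → List ℕ → Set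
IsPartitionN n lam =
  (length lam ≡ n) × ((∀ k a b → lam !? k ≡ just a → lam !? suc k ≡ just b → b ≤ a)
                     × (lam !? (n ∸ 1) ≡ just 0))

mu : ℕ → List ℕ → List ℕ
mu n lam = zipWith _+_ lam (downFrom n)

maxL : List ℕ → ℕ
maxL = foldr _⊔_ 0

conj : List ℕ → List ℕ
conj μ = map (λ j → length (filterᵇ (λ a → j ≤ᵇ a) μ)) (map suc (upTo (maxL μ)))

InF : List ℕ → ℕ → List (List ℕ) → Set
InF μ n T =
  (map length T ≡ conj μ)
  × (∀ r j x → ent T r j ≡ just x → (1 ≤ x) × (x ≤ n))
  × (∀ r r' j x y → ent T r j ≡ just x → ent T r' j ≡ just y → r ≢ r' → x ≢ y)
  × (∀ r k j x y → k < r → ent T r j ≡ just x → ent T k (suc j) ≡ just y → x ≢ y)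
  × (∀ r j x y → ent T r j ≡ just x → ent T r (suc j) ≡ just y → x ≤ y)

invCount : List ℕ → List ℕ → ℕ
invCount A B = sum (map (λ j → sum (map (λ i → cnt j i) (upTo (length B)))) (upTo (length A)))
  where
  cnt : ℕ → ℕ → ℕ
  cnt j i with A !? j | B !? i
  ... | just σu | just σv =
        if (i <ᵇ j) ∧ (σu <ᵇ σv) ∧ wOK
        then 1 else 0
        where
        wOK : Bool
        wOK with B !? j
        ... | nothing = true
        ... | just σw = σv <ᵇ σw
  ... | _ | _ = 0

inv : List (List ℕ) → ℕ
inv [] = 0
inv (A ∷ []) = 0
inv (A ∷ B ∷ rest) = invCount A B + inv (B ∷ rest)

memᵇ : ℕ → List ℕ → Bool
memᵇ x S = any (λ y → x ≡ᵇ y) S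

decreasing : List ℕ → List ℕ
decreasing S = filterᵇ (λ x → memᵇ x S) (downFrom (suc (maxL S)))

setAt : ℕ → ℕ → List (Maybe ℕ) → List (Maybe ℕ)
setAt _ x [] = []
setAt zero x (_ ∷ s) = just x ∷ s
setAt (suc r) x (m ∷ s) = m ∷ setAt r x s

rowOf : ℕ → List ℕ → Maybe ℕ
rowOf x [] = nothing
rowOf x (y ∷ ys) = if x ≡ᵇ y then just 0 else mapMaybe suc (rowOf x ys)

isEmptyAt : List (Maybe ℕ) → ℕ → Bool
isEmptyAt s r with s !? r
... | just nothing = true
... | _ = false

-- the row of the largest entry of C' whose row in the left column is empty
bestRow : List ℕ → List (Maybe ℕ) → Maybe ℕ
bestRow C' s = mapMaybe proj₁ (foldr step nothing (zip (upTo (length C')) C'))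
  where
  better : ℕ × ℕ → Maybe (ℕ × ℕ) → Maybe (ℕ × ℕ)
  better p nothing = just p
  better (r , v) (just (r' , v')) = if v' <ᵇ v then just (r , v) else just (r' , v')
  step : ℕ × ℕ → Maybe (ℕ × ℕ) → Maybe (ℕ × ℕ)
  step (r , v) acc = if isEmptyAt s r then better (r , v) acc else acc

hatStep : List ℕ → ℕ → List (Maybe ℕ) → ℕ → List (Maybe ℕ)
hatStep C' c s x with rowOf x C'
... | just r = setAt r x s
... | nothing =
  if (c ≡ᵇ suc (length C')) ∧ isEmptyAt s (length C')
  then setAt (length C') x s
  else place (bestRow C' s)
  where
  place : Maybe ℕ → List (Maybe ℕ)
  place (just r) = setAt r x s
  place nothing = s

hat : List ℕ → List ℕ → List ℕ
hat S C' = map (fromMaybe 0) (foldl (hatStep C' c) (replicate c nothing) (decreasing S))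
  where c = length S

-- Pivots of (Ĉ, C): triples (q, b_q, d_q), d_q = nothing meaning ∞

Pivot : Set
Pivot = ℕ × ℕ × Maybe ℕ

pivotsFrom : ℕ → List ℕ → List ℕ → List Pivot
pivotsFrom q [] _ = []
pivotsFrom q (b ∷ bs) [] = (q , b , nothing) ∷ []          -- q = |C|+1 ≤ |Ĉ|
pivotsFrom q (b ∷ bs) (d ∷ ds) =
  if b <ᵇ d then (q , b , just d) ∷ pivotsFrom (suc q) bs ds
  else pivotsFrom (suc q) bs ds

pivots : List ℕ → List ℕ → List Pivot
pivots Chat C = pivotsFrom 0 Chat C

InInterval : ℕ → Pivot → Set
InInterval x (q , b , nothing) = b ≤ x
InInterval x (q , b , just d) = (b ≤ x) × (x ≤ d)

Disjoint : Pivot → Pivot → Set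
Disjoint p p' = ∀ x → ¬ (InInterval x p × InInterval x p')

NonOverlapping : List ℕ → List ℕ → Set
NonOverlapping Chat C = (length (pivots Chat C) ≤ 1) ⊎ AllPairs Disjoint (pivots Chat C)

Nhat : List ℕ → List ℕ → ℕ
Nhat Chat C = sum (map term (pivots Chat C))
  where
  below : Maybe ℕ → ℕ → Bool
  below nothing x = true
  below (just d) x = x <ᵇ d
  term : Pivot → ℕ
  term (q , b , d) =
    length (filterᵇ (λ x → memᵇ x Chat ∧ (b <ᵇ x) ∧ below d x) (take q C))

{-# OPTIONS --safe #-}
-- Since inv (Ĉ ∷ C_i ∷ T') = invCount Ĉ C_i + inv (C_i ∷ T'), only the inversions between Ĉ and C_i
-- must be counted. Two facts reduce them to pivots.
--
-- Ĉ lies weakly left of C_i row by row. Rows of T weakly increase, so C_{i-1} ≤ C_i row by row,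
-- and |C_{i-1}| ≤ |C_i| + 1 because μ has distinct parts. The hat construction places the values
-- of C_{i-1} in decreasing order; Hall-type counting (the values ≥ t still to be placed never
-- outnumber the empty rows that can hold a value ≥ t) shows that every value lands beside an
-- entry of C_i at least as large.
--
-- An inversion between row j of Ĉ and a higher row of C_i needs Ĉ(j) < C_i(i') < C_i(j), so row j
-- is a pivot and C_i(i') lies in its interval. If C_i(i') did not occur in Ĉ, then
-- Ĉ(i') < C_i(i') and row i' would be a second pivot whose interval meets the first. So the
-- inversions at pivot row j are exactly the entries counted by N̂(i).
module Submission where

open import Defs
open import Data.Nat using (ℕ; zero; suc; _+_; _∸_; _≤_; _<_; _>_; _≡ᵇ_; _<ᵇ_; _≤ᵇ_; z≤n; s≤s)
open import Data.Nat.Properties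
  using (≡ᵇ⇒≡; ≡⇒≡ᵇ; <ᵇ⇒<; <⇒<ᵇ; ≤ᵇ⇒≤; ≤⇒≤ᵇ; ≤-refl; ≤-reflexive; ≤-trans; ≤-antisym; ≤-pred; <-trans;
         <-irrefl; <-≤-trans; <⇒≤; >⇒≢; ≰⇒>; ≮⇒≥; m≤n⇒m<n∨m≡n; n≤1+n; m≤n⇒m≤1+n; m≤n+m;
         +-mono-≤-<; +-comm; +-suc; +-identityʳ; module ≤-Reasoning)
open import Data.Bool using (Bool; true; false; if_then_else_; _∧_; T; T?)
open import Data.Bool.Properties using (T-≡; T-∧)
open import Data.List
  using (List; []; _∷_; _++_; length; map; foldr; foldl; filterᵇ; upTo; applyUpTo; downFrom; take; drop;
         zip; zipWith; replicate)
open import Data.List.Relation.Unary.Linked using (Linked; []; [-]; _∷_)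
open import Data.List.Relation.Unary.Linked.Properties using (Linked⇒AllPairs)
open import Data.List.Membership.Propositional using (_∈_)
open import Data.List.Membership.Propositional.Properties
  using (∈-∃++; ∈-++⁻; ∈-++⁺ˡ; ∈-++⁺ʳ; ∈-filter⁻; ∈-filter⁺)
open import Data.List.Relation.Binary.Subset.Propositional using (_⊆_)
open import Data.List.Relation.Unary.Unique.Propositional using (Unique)
import Data.List.Relation.Unary.AllPairs.Properties as AllPairsₚ
open import Data.List.Relation.Unary.Any as Any using (here; there)
open import Data.List.Relation.Unary.Any.Properties using (any⁺; any⁻)
open import Data.List.Relation.Unary.All using (All; []; _∷_)
open import Data.List.Relation.Unary.AllPairs using (AllPairs; []; _∷_)
import Data.List.Relation.Unary.AllPairs as AllPairs
import Data.List.Relation.Unary.All as All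
open import Data.List.Properties using (map-cong; length-map; length-replicate; length-++-sucʳ)
open import Data.Maybe.Properties using (just-injective)
open import Data.Nat.ListAction using (sum)
open import Data.Maybe using (Maybe; just; nothing; maybe′; fromMaybe) renaming (map to mapMaybe)
open import Data.Product using (_×_; _,_; proj₁; proj₂; ∃-syntax)
open import Data.Sum using (_⊎_; inj₁; inj₂)
open import Data.Empty using (⊥-elim)
open import Function using (_∘_; id; Equivalence)
open import Relation.Binary using (Symmetric)
open import Relation.Binary.PropositionalEquality
  using (_≡_; _≢_; refl; sym; trans; cong; cong₂; subst; subst₂; module ≡-Reasoning)

true⇒T : ∀ {b} → b ≡ true → T b
true⇒T = Equivalence.from T-≡

T⇒true : ∀ {b} → T b → b ≡ true
T⇒true = Equivalence.to T-≡

sumTo : ℕ → (ℕ → ℕ) → ℕ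
sumTo zero f = 0
sumTo (suc n) f = f 0 + sumTo n (f ∘ suc)

sum-map-applyUpTo : ∀ (f g : ℕ → ℕ) n → sum (map f (applyUpTo g n)) ≡ sumTo n (f ∘ g)
sum-map-applyUpTo f g zero = refl
sum-map-applyUpTo f g (suc n) = cong (f (g 0) +_) (sum-map-applyUpTo f (g ∘ suc) n)

sumTo-cong : ∀ n {f g : ℕ → ℕ} → (∀ k → f k ≡ g k) → sumTo n f ≡ sumTo n g
sumTo-cong zero f≗g = refl
sumTo-cong (suc n) f≗g = cong₂ _+_ (f≗g 0) (sumTo-cong n (f≗g ∘ suc))

sumTo-zero : ∀ n {f : ℕ → ℕ} → (∀ k → f k ≡ 0) → sumTo n f ≡ 0
sumTo-zero n f≗0 = trans (sumTo-cong n f≗0) (zeros n)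
  where
  zeros : ∀ n → sumTo n (λ _ → 0) ≡ 0
  zeros zero = refl
  zeros (suc n) = zeros n

module _ {A : Set} where

  !?-just⇒< : ∀ (xs : List A) {k x} → xs !? k ≡ just x → k < length xs
  !?-just⇒< (y ∷ xs) {zero} _ = s≤s z≤n
  !?-just⇒< (y ∷ xs) {suc k} e = s≤s (!?-just⇒< xs e)

  !?-nothing⇒≥ : ∀ (xs : List A) {k} → xs !? k ≡ nothing → length xs ≤ k
  !?-nothing⇒≥ [] e = z≤n
  !?-nothing⇒≥ (y ∷ xs) {suc k} e = s≤s (!?-nothing⇒≥ xs e)

  !?-<⇒just : ∀ (xs : List A) {k} → k < length xs → ∃[ x ] xs !? k ≡ just x
  !?-<⇒just (y ∷ xs) {zero} _ = y , refl
  !?-<⇒just (y ∷ xs) {suc k} (s≤s k<n) = !?-<⇒just xs k<n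

  !?-length : ∀ (xs : List A) → xs !? length xs ≡ nothing
  !?-length [] = refl
  !?-length (y ∷ xs) = !?-length xs

  !?⇒∈ : ∀ (xs : List A) {k x} → xs !? k ≡ just x → x ∈ xs
  !?⇒∈ (y ∷ xs) {zero} refl = here refl
  !?⇒∈ (y ∷ xs) {suc k} e = there (!?⇒∈ xs e)

  ∈-remove : ∀ (ys₁ : List A) {x y ys₂} → y ∈ ys₁ ++ x ∷ ys₂ → x ≢ y → y ∈ ys₁ ++ ys₂
  ∈-remove ys₁ y∈ x≢y with ∈-++⁻ ys₁ y∈
  ... | inj₁ y∈ys₁ = ∈-++⁺ˡ y∈ys₁
  ... | inj₂ (here refl) = ⊥-elim (x≢y refl)
  ... | inj₂ (there y∈ys₂) = ∈-++⁺ʳ ys₁ y∈ys₂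

  unique-⊆⇒length≤ : ∀ {xs ys : List A} → Unique xs → xs ⊆ ys → length xs ≤ length ys
  unique-⊆⇒length≤ {[]} _ _ = z≤n
  unique-⊆⇒length≤ {x ∷ xs} (x∉xs ∷ unique) xs⊆ys with ∈-∃++ (xs⊆ys (here refl))
  ... | ys₁ , ys₂ , refl =
    subst (suc (length xs) ≤_) (sym (length-++-sucʳ ys₁ x ys₂))
      (s≤s (unique-⊆⇒length≤ unique λ y∈xs →
        ∈-remove ys₁ (xs⊆ys (there y∈xs)) (All.lookup x∉xs y∈xs)))

  drop-!? : ∀ k (xs : List A) {y ys} → drop k xs ≡ y ∷ ys → xs !? k ≡ just y
  drop-!? zero (x ∷ xs) refl = refl
  drop-!? (suc k) (x ∷ xs) e = drop-!? k xs e

  drop-∷ : ∀ k (xs : List A) {y ys} → drop k xs ≡ y ∷ ys → drop (suc k) xs ≡ ys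
  drop-∷ zero (x ∷ xs) refl = refl
  drop-∷ (suc k) (x ∷ xs) e = drop-∷ k xs e

  !?-map⁺ : ∀ {B : Set} (f : A → B) xs {k x} → xs !? k ≡ just x → map f xs !? k ≡ just (f x)
  !?-map⁺ f (y ∷ xs) {zero} refl = refl
  !?-map⁺ f (y ∷ xs) {suc k} e = !?-map⁺ f xs e

  !?-map⁻ : ∀ {B : Set} (f : A → B) xs {k v} → map f xs !? k ≡ just v
    → ∃[ x ] (xs !? k ≡ just x × v ≡ f x)
  !?-map⁻ f (y ∷ xs) {zero} refl = y , refl , refl
  !?-map⁻ f (y ∷ xs) {suc k} e = !?-map⁻ f xs e

  !?-applyUpTo : ∀ (f : ℕ → A) n {k v} → applyUpTo f n !? k ≡ just v → v ≡ f k
  !?-applyUpTo f (suc n) {zero} refl = refl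
  !?-applyUpTo f (suc n) {suc k} e = !?-applyUpTo (f ∘ suc) n e

  ∈-zip-applyUpTo : ∀ (f : ℕ → ℕ) (C : List A) {r v} → (r , v) ∈ zip (applyUpTo f (length C)) C
    → ∃[ k ] (f k ≡ r × C !? k ≡ just v)
  ∈-zip-applyUpTo f (v ∷ C) (here refl) = 0 , refl , refl
  ∈-zip-applyUpTo f (w ∷ C) (there rv∈) with ∈-zip-applyUpTo (f ∘ suc) C rv∈
  ... | k , fk≡r , e = suc k , fk≡r , e

  !?⇒∈-zip-applyUpTo : ∀ (f : ℕ → ℕ) (C : List A) {k v} → C !? k ≡ just v
    → (f k , v) ∈ zip (applyUpTo f (length C)) C
  !?⇒∈-zip-applyUpTo f (w ∷ C) {zero} refl = here refl
  !?⇒∈-zip-applyUpTo f (w ∷ C) {suc k} e = there (!?⇒∈-zip-applyUpTo (f ∘ suc) C e)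

  nothing≢just : ∀ {x : A} → nothing ≢ just x
  nothing≢just ()

  AllPairs-∈ : ∀ {R : A → A → Set} {xs x y} → Symmetric R → AllPairs R xs
    → x ∈ xs → y ∈ xs → x ≢ y → R x y
  AllPairs-∈ R-sym (Rx ∷ Rxs) (here refl) (here refl) x≢y = ⊥-elim (x≢y refl)
  AllPairs-∈ R-sym (Rx ∷ Rxs) (here refl) (there y∈) x≢y = All.lookup Rx y∈
  AllPairs-∈ R-sym (Ry ∷ Rxs) (there x∈) (here refl) x≢y = R-sym (All.lookup Ry x∈)
  AllPairs-∈ R-sym (_ ∷ Rxs) (there x∈) (there y∈) x≢y = AllPairs-∈ R-sym Rxs x∈ y∈ x≢y

  ∈-distinct⇒2≤length : ∀ {xs : List A} {x y} → x ∈ xs → y ∈ xs → x ≢ y → 2 ≤ length xs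
  ∈-distinct⇒2≤length (here refl) (here refl) x≢y = ⊥-elim (x≢y refl)
  ∈-distinct⇒2≤length (here refl) (there (here _)) x≢y = s≤s (s≤s z≤n)
  ∈-distinct⇒2≤length (here refl) (there (there _)) x≢y = s≤s (s≤s z≤n)
  ∈-distinct⇒2≤length (there (here _)) _ x≢y = s≤s (s≤s z≤n)
  ∈-distinct⇒2≤length (there (there _)) _ x≢y = s≤s (s≤s z≤n)

∈⇒memᵇ : ∀ {x xs} → x ∈ xs → T (memᵇ x xs)
∈⇒memᵇ {x} = any⁺ _ ∘ Any.map (λ { refl → ≡⇒≡ᵇ x x refl })

memᵇ⇒∈ : ∀ {x} xs → T (memᵇ x xs) → x ∈ xs
memᵇ⇒∈ xs = Any.map (≡ᵇ⇒≡ _ _) ∘ any⁻ _ xs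

_≤ʳ_ : List ℕ → List ℕ → Set
A ≤ʳ B = ∀ {r a b} → A !? r ≡ just a → B !? r ≡ just b → a ≤ b

count≥ : ℕ → List ℕ → ℕ
count≥ t L = length (filterᵇ (t ≤ᵇ_) L)

count≥-∷ : ∀ t x L → (t ≤ᵇ x) ≡ true → count≥ t (x ∷ L) ≡ suc (count≥ t L)
count≥-∷ t x L t≤x rewrite t≤x = refl

count≥-all-< : ∀ {t} L → All (_< t) L → count≥ t L ≡ 0
count≥-all-< [] [] = refl
count≥-all-< {t} (x ∷ L) (x<t ∷ L<t) with t ≤ᵇ x in t≤x
... | true = ⊥-elim (<-irrefl refl (<-≤-trans x<t (≤ᵇ⇒≤ t x (true⇒T t≤x))))
... | false = count≥-all-< L L<t

count≥-∷-≤ : ∀ t x L → count≥ t (x ∷ L) ≤ suc (count≥ t L)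
count≥-∷-≤ t x L with t ≤ᵇ x
... | true = ≤-refl
... | false = n≤1+n _

count≥-descending : ∀ m μ → AllPairs _>_ μ → count≥ m μ ≤ suc (count≥ (suc m) μ)
count≥-descending m [] [] = z≤n
count≥-descending m (a ∷ l) (a>l ∷ desc) with suc m ≤ᵇ a in m<a
... | true rewrite count≥-∷ m a l (T⇒true (≤⇒≤ᵇ (<⇒≤ (≤ᵇ⇒≤ (suc m) a (true⇒T m<a)))))
  = s≤s (count≥-descending m l desc)
... | false = ≤-trans (count≥-∷-≤ m a l)
                (s≤s (subst (_≤ count≥ (suc m) l) (sym (count≥-all-< l l<m)) z≤n))
  where
  a≤m : a ≤ m
  a≤m = ≤-pred (≰⇒> (λ m<a′ → subst T m<a (≤⇒≤ᵇ m<a′)))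
  l<m : All (_< m) l
  l<m = All.map (λ y<a → <-≤-trans y<a a≤m) a>l

belowᵇ : Maybe ℕ → ℕ → Bool
belowᵇ nothing x = true
belowᵇ (just d) x = x <ᵇ d

-- pairInversion j i σu σv σw is the inv indicator for u in row j of the left column, v in row i
-- of the right one and w in row j of the right one (σw = nothing when w is not a cell).
pairInversion : ℕ → ℕ → Maybe ℕ → Maybe ℕ → Maybe ℕ → ℕ
pairInversion j i (just u) (just v) w = if (i <ᵇ j) ∧ (u <ᵇ v) ∧ belowᵇ w v then 1 else 0
pairInversion j i (just u) nothing w = 0
pairInversion j i nothing σv w = 0

-- The summand of invCount is local to its definition; unifying with refl names it.
InvCountSummand : (A B : List ℕ) (f : ℕ → ℕ → ℕ)
  → invCount A B ≡ sum (map (λ j → sum (map (f j) (upTo (length B)))) (upTo (length A))) → Set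
InvCountSummand A B f _ = ∀ j i → f j i ≡ pairInversion j i (A !? j) (B !? i) (B !? j)

invCount-summand : ∀ A B → InvCountSummand A B _ refl
invCount-summand A B j i with A !? j | B !? i
... | nothing | _ = refl
... | just u | nothing = refl
... | just u | just v with B !? j
...   | nothing = refl
...   | just w = refl

invCount-as-sumTo : ∀ A B → invCount A B
  ≡ sumTo (length A) (λ j → sumTo (length B) (λ i → pairInversion j i (A !? j) (B !? i) (B !? j)))
invCount-as-sumTo A B =
  trans (sum-map-applyUpTo _ _ (length A))
    (sumTo-cong (length A) λ j →
      trans (sum-map-applyUpTo _ _ (length B)) (sumTo-cong (length B) (invCount-summand A B j)))

pivotAt : ℕ → List ℕ → List ℕ → ℕ → Maybe Pivot
pivotAt q [] C k = nothing
pivotAt q (b ∷ H) [] zero = just (q , b , nothing)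
pivotAt q (b ∷ H) [] (suc k) = nothing
pivotAt q (b ∷ H) (d ∷ C) zero = if b <ᵇ d then just (q , b , just d) else nothing
pivotAt q (b ∷ H) (d ∷ C) (suc k) = pivotAt (suc q) H C k

sum-pivotsFrom : ∀ (g : Pivot → ℕ) q H C
  → sum (map g (pivotsFrom q H C)) ≡ sumTo (length H) (maybe′ g 0 ∘ pivotAt q H C)
sum-pivotsFrom g q [] C = refl
sum-pivotsFrom g q (b ∷ H) [] = cong (g (q , b , nothing) +_) (sym (sumTo-zero (length H) λ _ → refl))
sum-pivotsFrom g q (b ∷ H) (d ∷ C) with b <ᵇ d
... | true = cong (g (q , b , just d) +_) (sum-pivotsFrom g (suc q) H C)
... | false = sum-pivotsFrom g (suc q) H C

pivotAt-∈ : ∀ q H C k {p} → pivotAt q H C k ≡ just p → p ∈ pivotsFrom q H C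
pivotAt-∈ q (b ∷ H) [] zero refl = here refl
pivotAt-∈ q (b ∷ H) (d ∷ C) zero e with b <ᵇ d
pivotAt-∈ q (b ∷ H) (d ∷ C) zero refl | true = here refl
pivotAt-∈ q (b ∷ H) (d ∷ C) (suc k) e with b <ᵇ d
... | true = there (pivotAt-∈ (suc q) H C k e)
... | false = pivotAt-∈ (suc q) H C k e

pivotAt-empty : ∀ q H C {k} → H !? k ≡ nothing → pivotAt q H C k ≡ nothing
pivotAt-empty q [] C e = refl
pivotAt-empty q (b ∷ H) [] {suc k} e = refl
pivotAt-empty q (b ∷ H) (d ∷ C) {suc k} e = pivotAt-empty (suc q) H C e

pivotAt-< : ∀ q H C {k b d} → H !? k ≡ just b → C !? k ≡ just d → b < d
  → pivotAt q H C k ≡ just (q + k , b , just d)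
pivotAt-< q (b ∷ H) (d ∷ C) {zero} refl refl b<d
  rewrite T⇒true (<⇒<ᵇ b<d) | +-identityʳ q = refl
pivotAt-< q (b ∷ H) (d ∷ C) {suc k} eH eC b<d
  rewrite +-suc q k = pivotAt-< (suc q) H C eH eC b<d

pivotAt-≮ : ∀ q H C {k b d} → H !? k ≡ just b → C !? k ≡ just d → (b <ᵇ d) ≡ false
  → pivotAt q H C k ≡ nothing
pivotAt-≮ q (b ∷ H) (d ∷ C) {zero} refl refl b≮d rewrite b≮d = refl
pivotAt-≮ q (b ∷ H) (d ∷ C) {suc k} eH eC b≮d = pivotAt-≮ (suc q) H C eH eC b≮d

pivotAt-length : ∀ q H C {b} → H !? length C ≡ just b
  → pivotAt q H C (length C) ≡ just (q + length C , b , nothing)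
pivotAt-length q (b ∷ H) [] refl rewrite +-identityʳ q = refl
pivotAt-length q (b ∷ H) (d ∷ C) e rewrite +-suc q (length C) = pivotAt-length (suc q) H C e

pivotWeight : List ℕ → List ℕ → Pivot → ℕ
pivotWeight H C (q , b , d) = length (filterᵇ (λ x → memᵇ x H ∧ (b <ᵇ x) ∧ belowᵇ d x) (take q C))

Nhat-as-sumTo : ∀ H C → Nhat H C ≡ sumTo (length H) (maybe′ (pivotWeight H C) 0 ∘ pivotAt 0 H C)
Nhat-as-sumTo H C =
  trans (cong sum (map-cong (λ { (q , b , just d) → refl ; (q , b , nothing) → refl }) (pivots H C)))
        (sum-pivotsFrom (pivotWeight H C) 0 H C)

holdsAbove : ℕ → (ℕ → Bool) → ℕ → Maybe ℕ → ℕ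
holdsAbove j P i = maybe′ (λ v → if (i <ᵇ j) ∧ P v then 1 else 0) 0

length-filter-take : ∀ (P : ℕ → Bool) L j
  → length (filterᵇ P (take j L)) ≡ sumTo (length L) (λ i → holdsAbove j P i (L !? i))
length-filter-take P [] zero = refl
length-filter-take P [] (suc j) = refl
length-filter-take P (v ∷ L) zero = sym (sumTo-zero (length L) nothing-above-0)
  where
  nothing-above-0 : ∀ i → holdsAbove 0 P (suc i) (L !? i) ≡ 0
  nothing-above-0 i with L !? i
  ... | nothing = refl
  ... | just w = refl
length-filter-take P (v ∷ L) (suc j) with P v
... | true = cong suc (length-filter-take P L j)
... | false = length-filter-take P L j

Disjoint-sym : Symmetric Disjoint
Disjoint-sym p#p' x (x∈p' , x∈p) = p#p' x (x∈p , x∈p')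

pivots-disjoint : ∀ H C {p p'} → NonOverlapping H C
  → p ∈ pivots H C → p' ∈ pivots H C → p ≢ p' → Disjoint p p'
pivots-disjoint H C (inj₁ ≤1) p∈ p'∈ p≢p' with ≤-trans (∈-distinct⇒2≤length p∈ p'∈ p≢p') ≤1
... | s≤s ()
pivots-disjoint H C (inj₂ disjoint) = AllPairs-∈ Disjoint-sym disjoint

belowᵇ⇒InInterval : ∀ {j b v} d → b < v → belowᵇ d v ≡ true → InInterval v (j , b , d)
belowᵇ⇒InInterval nothing b<v _ = <⇒≤ b<v
belowᵇ⇒InInterval (just d) b<v v<d = <⇒≤ b<v , <⇒≤ (<ᵇ⇒< _ d (true⇒T v<d))

pairInversion-≮ : ∀ j i {b d} m → (b <ᵇ d) ≡ false → pairInversion j i (just b) m (just d) ≡ 0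
pairInversion-≮ j i nothing b≮d = refl
pairInversion-≮ j i {b} {d} (just v) b≮d
  with i <ᵇ j | b <ᵇ v in b<v | v <ᵇ d in v<d
... | false | _ | _ = refl
... | true | false | _ = refl
... | true | true | false = refl
... | true | true | true =
  ⊥-elim (subst T b≮d (<⇒<ᵇ (<-trans (<ᵇ⇒< b v (true⇒T b<v)) (<ᵇ⇒< v d (true⇒T v<d)))))

module PivotCount (H C : List ℕ) (H≤C : H ≤ʳ C) (no : NonOverlapping H C)
                  (short : length H ≤ suc (length C)) where

  -- Such an entry v equals its left neighbour a: a < v would make [a, v] a second pivot
  -- interval containing v.
  inside-pivot-interval-∈ : ∀ {i j v b d} → i < j → C !? i ≡ just v → H !? j ≡ just b
    → pivotAt 0 H C j ≡ just (j , b , d) → InInterval v (j , b , d) → v ∈ H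
  inside-pivot-interval-∈ {i} {j} {v} i<j eC eH eP v∈I
    with !?-<⇒just H (<-trans i<j (!?-just⇒< H eH))
  ... | a , eA with m≤n⇒m<n∨m≡n (H≤C eA eC)
  ...   | inj₂ refl = !?⇒∈ H eA
  ...   | inj₁ a<v = ⊥-elim (pivots-disjoint H C no
            (pivotAt-∈ 0 H C i (pivotAt-< 0 H C eA eC a<v)) (pivotAt-∈ 0 H C j eP)
            (λ e → <-irrefl (cong proj₁ e) i<j) v ((<⇒≤ a<v , ≤-refl) , v∈I))

  pairInversion-pivot : ∀ {j b d} → H !? j ≡ just b → pivotAt 0 H C j ≡ just (j , b , d) → ∀ i
    → pairInversion j i (just b) (C !? i) d
      ≡ holdsAbove j (λ x → memᵇ x H ∧ (b <ᵇ x) ∧ belowᵇ d x) i (C !? i)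
  pairInversion-pivot {j} {b} {d} eH eP i with C !? i in eC
  ... | nothing = refl
  ... | just v with memᵇ v H in v∈H
  ...   | true = refl
  ...   | false with i <ᵇ j in i<j | b <ᵇ v in b<v | belowᵇ d v in v<d
  ...     | false | _ | _ = refl
  ...     | true | false | _ = refl
  ...     | true | true | false = refl
  ...     | true | true | true = ⊥-elim (subst T v∈H (∈⇒memᵇ
              (inside-pivot-interval-∈ (<ᵇ⇒< i j (true⇒T i<j)) eC eH eP
                 (belowᵇ⇒InInterval d (<ᵇ⇒< b v (true⇒T b<v)) v<d))))

  pivot-row : ∀ {j b d} → H !? j ≡ just b → pivotAt 0 H C j ≡ just (j , b , d)
    → sumTo (length C) (λ i → pairInversion j i (just b) (C !? i) d) ≡ maybe′ (pivotWeight H C) 0 (pivotAt 0 H C j)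
  pivot-row {j} eH eP =
    trans (sumTo-cong (length C) (pairInversion-pivot eH eP))
          (trans (sym (length-filter-take _ C j)) (cong (maybe′ (pivotWeight H C) 0) (sym eP)))

  pivotAt-beyond : ∀ {j b} → H !? j ≡ just b → C !? j ≡ nothing → pivotAt 0 H C j ≡ just (j , b , nothing)
  pivotAt-beyond eH eC with ≤-antisym (≤-pred (≤-trans (!?-just⇒< H eH) short)) (!?-nothing⇒≥ C eC)
  ... | refl = pivotAt-length 0 H C eH

  row-inversions : ∀ j → sumTo (length C) (λ i → pairInversion j i (H !? j) (C !? i) (C !? j))
    ≡ maybe′ (pivotWeight H C) 0 (pivotAt 0 H C j)
  row-inversions j with H !? j in eH
  ... | nothing = trans (sumTo-zero (length C) (λ _ → refl))
                        (cong (maybe′ (pivotWeight H C) 0) (sym (pivotAt-empty 0 H C eH)))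
  ... | just b with C !? j in eC
  ...   | nothing = pivot-row eH (pivotAt-beyond eH eC)
  ...   | just d with b <ᵇ d in b<d
  ...     | true = pivot-row eH (pivotAt-< 0 H C eH eC (<ᵇ⇒< b d (true⇒T b<d)))
  ...     | false = trans (sumTo-zero (length C) (λ i → pairInversion-≮ j i (C !? i) b<d))
                          (cong (maybe′ (pivotWeight H C) 0) (sym (pivotAt-≮ 0 H C eH eC b<d)))

  invCount≡Nhat : invCount H C ≡ Nhat H C
  invCount≡Nhat = begin
    invCount H C
      ≡⟨ invCount-as-sumTo H C ⟩
    sumTo (length H) (λ j → sumTo (length C) (λ i → pairInversion j i (H !? j) (C !? i) (C !? j)))
      ≡⟨ sumTo-cong (length H) row-inversions ⟩
    sumTo (length H) (maybe′ (pivotWeight H C) 0 ∘ pivotAt 0 H C)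
      ≡⟨ sym (Nhat-as-sumTo H C) ⟩
    Nhat H C ∎
    where open ≡-Reasoning

record IsArgMaxStep (keep : ℕ → Bool) (step : ℕ × ℕ → Maybe (ℕ × ℕ) → Maybe (ℕ × ℕ)) : Set where
  field
    skip : ∀ {r v} acc → keep r ≡ false → step (r , v) acc ≡ acc
    start : ∀ {r v} → keep r ≡ true → step (r , v) nothing ≡ just (r , v)
    replace : ∀ {r v r' v'} → keep r ≡ true → (v' <ᵇ v) ≡ true
      → step (r , v) (just (r' , v')) ≡ just (r , v)
    retain : ∀ {r v r' v'} → keep r ≡ true → (v' <ᵇ v) ≡ false
      → step (r , v) (just (r' , v')) ≡ just (r' , v')

module ArgMax {keep step} (isArgMaxStep : IsArgMaxStep keep step) where
  open IsArgMaxStep isArgMaxStep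

  argmax : List (ℕ × ℕ) → Maybe (ℕ × ℕ)
  argmax = foldr step nothing

  argmax-∈ : ∀ ps {p} → argmax ps ≡ just p → p ∈ ps
  argmax-∈ ((r , v) ∷ ps) e with keep r in kept
  ... | false = there (argmax-∈ ps (trans (sym (skip (argmax ps) kept)) e))
  ... | true with argmax ps in e'
  ...   | nothing with trans (sym (start kept)) e
  ...     | refl = here refl
  argmax-∈ ((r , v) ∷ ps) e | true | just (r' , v') with v' <ᵇ v in v'<v
  ...     | true with trans (sym (replace kept v'<v)) e
  ...       | refl = here refl
  argmax-∈ ((r , v) ∷ ps) e | true | just (r' , v') | false with trans (sym (retain kept v'<v)) e
  ...       | refl = there (argmax-∈ ps e')

  argmax-≥ : ∀ ps {r v} → (r , v) ∈ ps → keep r ≡ true → ∃[ p ] (argmax ps ≡ just p × v ≤ proj₂ p)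
  argmax-≥ ((r , v) ∷ ps) (here refl) kept with argmax ps
  ... | nothing = (r , v) , start kept , ≤-refl
  ... | just (r' , v') with v' <ᵇ v in v'<v
  ...   | true = (r , v) , replace kept v'<v , ≤-refl
  ...   | false = (r' , v') , retain kept v'<v , ≮⇒≥ (λ lt → subst T v'<v (<⇒<ᵇ lt))
  argmax-≥ ((r₀ , v₀) ∷ ps) (there rv∈) kept with argmax-≥ ps rv∈ kept | keep r₀ in kept₀
  ... | p , e , v≤p | false = p , trans (skip (argmax ps) kept₀) e , v≤p
  ... | (r' , v') , e , v≤v' | true with v' <ᵇ v₀ in v'<v₀
  ...   | true = (r₀ , v₀) , trans (cong (step _) e) (replace kept₀ v'<v₀)
                  , ≤-trans v≤v' (<⇒≤ (<ᵇ⇒< v' v₀ (true⇒T v'<v₀)))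
  ...   | false = (r' , v') , trans (cong (step _) e) (retain kept₀ v'<v₀) , v≤v'

-- The folding step of bestRow is local to its definition; unifying with refl names it.
BestRowStep : (C : List ℕ) (s : List (Maybe ℕ)) (step : ℕ × ℕ → Maybe (ℕ × ℕ) → Maybe (ℕ × ℕ))
  → bestRow C s ≡ mapMaybe proj₁ (foldr step nothing (zip (upTo (length C)) C)) → Set
BestRowStep C s step _ = IsArgMaxStep (isEmptyAt s) step

bestRow-step : ∀ C s → BestRowStep C s _ refl
IsArgMaxStep.skip (bestRow-step C s) acc e rewrite e = refl
IsArgMaxStep.start (bestRow-step C s) e rewrite e = refl
IsArgMaxStep.replace (bestRow-step C s) e lt rewrite e | lt = refl
IsArgMaxStep.retain (bestRow-step C s) e lt rewrite e | lt = refl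

bestRow-maximal : ∀ C s {r v} → isEmptyAt s r ≡ true → C !? r ≡ just v
  → ∃[ r* ] ∃[ v* ] (bestRow C s ≡ just r* × C !? r* ≡ just v* × v ≤ v*)
bestRow-maximal C s {v = v} empty eC = maximal (argmax-≥ rows (!?⇒∈-zip-applyUpTo id C eC) empty)
  where
  open ArgMax (bestRow-step C s)
  rows : List (ℕ × ℕ)
  rows = zip (upTo (length C)) C
  maximal : ∃[ p ] (argmax rows ≡ just p × v ≤ proj₂ p)
    → ∃[ r* ] ∃[ v* ] (bestRow C s ≡ just r* × C !? r* ≡ just v* × v ≤ v*)
  maximal ((r* , v*) , e , v≤v*) =
    let k , k≡r* , eC* = ∈-zip-applyUpTo id C (argmax-∈ rows e)
    in r* , v* , cong (mapMaybe proj₁) e , subst (λ k → C !? k ≡ just v*) k≡r* eC* , v≤v*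

Fits : List ℕ → ℕ → ℕ → Set
Fits C r x = ∀ {v} → C !? r ≡ just v → x ≤ v

-- Empty rows of a partially built column s that can still take a value ≥ t: rows past the
-- end of C, or rows where C has an entry ≥ t.
freeRows : ℕ → List ℕ → List (Maybe ℕ) → ℕ
freeRows t C [] = 0
freeRows t [] (just _ ∷ s) = freeRows t [] s
freeRows t (v ∷ C) (just _ ∷ s) = freeRows t C s
freeRows t [] (nothing ∷ s) = suc (freeRows t [] s)
freeRows t (v ∷ C) (nothing ∷ s) = (if t ≤ᵇ v then 1 else 0) + freeRows t C s

freeRows-setAt : ∀ t C s r x → freeRows t C s ≤ suc (freeRows t C (setAt r x s))
freeRows-setAt t C [] r x = z≤n
freeRows-setAt t [] (just _ ∷ s) zero x = n≤1+n _
freeRows-setAt t (v ∷ C) (just _ ∷ s) zero x = n≤1+n _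
freeRows-setAt t [] (nothing ∷ s) zero x = ≤-refl
freeRows-setAt t (v ∷ C) (nothing ∷ s) zero x with t ≤ᵇ v
... | true = ≤-refl
... | false = n≤1+n _
freeRows-setAt t [] (just _ ∷ s) (suc r) x = freeRows-setAt t [] s r x
freeRows-setAt t (v ∷ C) (just _ ∷ s) (suc r) x = freeRows-setAt t C s r x
freeRows-setAt t [] (nothing ∷ s) (suc r) x = s≤s (freeRows-setAt t [] s r x)
freeRows-setAt t (v ∷ C) (nothing ∷ s) (suc r) x with t ≤ᵇ v
... | true = s≤s (freeRows-setAt t C s r x)
... | false = freeRows-setAt t C s r x

FreeRow : ℕ → List ℕ → List (Maybe ℕ) → ℕ → Set
FreeRow t C s r = s !? r ≡ just nothing × (C !? r ≡ nothing ⊎ ∃[ v ] (C !? r ≡ just v × t ≤ v))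

freeRow-exists : ∀ t C s → 1 ≤ freeRows t C s → ∃[ r ] FreeRow t C s r
freeRow-exists t [] (just _ ∷ s) pos with freeRow-exists t [] s pos
... | r , e , inj₁ end = suc r , e , inj₁ refl
... | r , e , inj₂ (v , () , _)
freeRow-exists t (v ∷ C) (just _ ∷ s) pos with freeRow-exists t C s pos
... | r , free = suc r , free
freeRow-exists t [] (nothing ∷ s) pos = zero , refl , inj₁ refl
freeRow-exists t (v ∷ C) (nothing ∷ s) pos with t ≤ᵇ v in t≤v
... | true = zero , refl , inj₂ (v , refl , ≤ᵇ⇒≤ t v (true⇒T t≤v))
... | false with freeRow-exists t C s pos
...   | r , free = suc r , free

freeRows-replicate : ∀ t S C → S ≤ʳ C → count≥ t S ≤ freeRows t C (replicate (length S) nothing)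
freeRows-replicate t [] C S≤C = z≤n
freeRows-replicate t (x ∷ S) [] S≤C with t ≤ᵇ x
... | true = s≤s (freeRows-replicate t S [] λ _ ())
... | false = m≤n⇒m≤1+n (freeRows-replicate t S [] λ _ ())
freeRows-replicate t (x ∷ S) (y ∷ C) S≤C with t ≤ᵇ x in t≤x
... | false = ≤-trans (freeRows-replicate t S C (λ {r} → S≤C {suc r})) (m≤n+m _ _)
... | true rewrite T⇒true (≤⇒≤ᵇ (≤-trans (≤ᵇ⇒≤ t x (true⇒T t≤x)) (S≤C {0} refl refl)))
  = s≤s (freeRows-replicate t S C (λ {r} → S≤C {suc r}))

length-setAt : ∀ r x s → length (setAt r x s) ≡ length s
length-setAt r x [] = refl
length-setAt zero x (m ∷ s) = refl
length-setAt (suc r) x (m ∷ s) = cong suc (length-setAt r x s)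

setAt-≤ʳ : ∀ {C} s r x → map (fromMaybe 0) s ≤ʳ C → Fits C r x → map (fromMaybe 0) (setAt r x s) ≤ʳ C
setAt-≤ʳ [] r x below fits = below
setAt-≤ʳ (m ∷ s) zero x below fits {zero} refl eC = fits eC
setAt-≤ʳ (m ∷ s) zero x below fits {suc k} eA eC = below {suc k} eA eC
setAt-≤ʳ {[]} (m ∷ s) (suc r) x below fits {k} eA ()
setAt-≤ʳ {c ∷ C} (m ∷ s) (suc r) x below fits {zero} eA eC = below {0} eA eC
setAt-≤ʳ {c ∷ C} (m ∷ s) (suc r) x below fits {suc k} eA eC =
  setAt-≤ʳ {C} s r x (λ {k} → below {suc k}) fits eA eC

blank-≤ʳ : ∀ c C → map (fromMaybe 0) (replicate c nothing) ≤ʳ C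
blank-≤ʳ (suc c) C {zero} refl _ = z≤n
blank-≤ʳ (suc c) [] {suc k} eA ()
blank-≤ʳ (suc c) (_ ∷ C) {suc k} eA eC = blank-≤ʳ c C eA eC

rowOf-!? : ∀ {x} C {r} → rowOf x C ≡ just r → C !? r ≡ just x
rowOf-!? {x} (y ∷ C) e with x ≡ᵇ y in x≡y
rowOf-!? {x} (y ∷ C) refl | true = cong just (sym (≡ᵇ⇒≡ x y (true⇒T x≡y)))
rowOf-!? {x} (y ∷ C) e | false with rowOf x C in e'
rowOf-!? {x} (y ∷ C) refl | false | just r = rowOf-!? C e'

isEmptyAt-nothing : ∀ s {r} → s !? r ≡ just nothing → isEmptyAt s r ≡ true
isEmptyAt-nothing s {r} e with s !? r
isEmptyAt-nothing s {r} refl | just nothing = refl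

hatStep-length : ∀ C c s x → length (hatStep C c s x) ≡ length s
hatStep-length C c s x with rowOf x C
... | just r = length-setAt r x s
... | nothing with (c ≡ᵇ suc (length C)) ∧ isEmptyAt s (length C)
...   | true = length-setAt (length C) x s
...   | false with bestRow C s
...     | just r = length-setAt r x s
...     | nothing = refl

foldl-hatStep-length : ∀ C c s L → length (foldl (hatStep C c) s L) ≡ length s
foldl-hatStep-length C c s [] = refl
foldl-hatStep-length C c s (x ∷ L) = trans (foldl-hatStep-length C c (hatStep C c s x) L) (hatStep-length C c s x)

length-hat : ∀ S C → length (hat S C) ≡ length S
length-hat S C = begin
  length (hat S C)
    ≡⟨ length-map (fromMaybe 0) (foldl (hatStep C (length S)) (replicate (length S) nothing) (decreasing S)) ⟩
  length (foldl (hatStep C (length S)) (replicate (length S) nothing) (decreasing S))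
    ≡⟨ foldl-hatStep-length C (length S) (replicate (length S) nothing) (decreasing S) ⟩
  length (replicate (length S) nothing)
    ≡⟨ length-replicate (length S) ⟩
  length S ∎
  where open ≡-Reasoning

hatStep-places : ∀ C c s x → c ≤ suc (length C) → length s ≡ c → 1 ≤ freeRows x C s
  → ∃[ r ] (hatStep C c s x ≡ setAt r x s × Fits C r x)
hatStep-places C c s x c≤ len room with rowOf x C in eR
... | just r = r , refl , λ eC → ≤-reflexive (just-injective (trans (sym (rowOf-!? C eR)) eC))
... | nothing with (c ≡ᵇ suc (length C)) ∧ isEmptyAt s (length C) in lastFree
...   | true = length C , refl , λ eC → ⊥-elim (nothing≢just (trans (sym (!?-length C)) eC))
...   | false with freeRow-exists x C s room
-- A free row past the end of C can only be row |C| with c = |C| + 1, taken by the branch above.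
...     | r , empty , inj₁ eC = ⊥-elim (subst T lastFree (Equivalence.from T-∧ (c≡ᵇ , isEmptyAt-last)))
  where
  r<c : r < c
  r<c = subst (r <_) len (!?-just⇒< s empty)
  r≡ : r ≡ length C
  r≡ = ≤-antisym (≤-pred (≤-trans r<c c≤)) (!?-nothing⇒≥ C eC)
  c≡ᵇ : T (c ≡ᵇ suc (length C))
  c≡ᵇ = ≡⇒≡ᵇ c (suc (length C)) (≤-antisym c≤ (subst (λ k → suc k ≤ c) r≡ r<c))
  isEmptyAt-last : T (isEmptyAt s (length C))
  isEmptyAt-last = true⇒T (isEmptyAt-nothing s (subst (λ k → s !? k ≡ just nothing) r≡ empty))
...     | r , empty , inj₂ (v , eC , x≤v) with bestRow-maximal C s (isEmptyAt-nothing s empty) eC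
...       | r* , v* , eB , eC* , v≤v* rewrite eB =
  r* , refl , λ e → ≤-trans x≤v (≤-trans v≤v* (≤-reflexive (just-injective (trans (sym eC*) e))))

decreasing-descending : ∀ S → AllPairs _>_ (decreasing S)
decreasing-descending S =
  AllPairsₚ.filter⁺ (T? ∘ λ x → memᵇ x S) (AllPairsₚ.applyDownFrom⁺₁ id (suc (maxL S)) λ j<i _ → j<i)

-- decreasing S lists every value of S exactly once.
count≥-decreasing : ∀ t S → count≥ t (decreasing S) ≤ count≥ t S
count≥-decreasing t S =
  unique-⊆⇒length≤ (AllPairs.map >⇒≢ (AllPairsₚ.filter⁺ (T? ∘ (t ≤ᵇ_)) (decreasing-descending S))) ⊆S
  where
  ⊆S : filterᵇ (t ≤ᵇ_) (decreasing S) ⊆ filterᵇ (t ≤ᵇ_) S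
  ⊆S y∈ with ∈-filter⁻ (T? ∘ (t ≤ᵇ_)) {xs = decreasing S} y∈
  ... | y∈dec , t≤y = ∈-filter⁺ (T? ∘ (t ≤ᵇ_)) (memᵇ⇒∈ S (proj₂ (∈-filter⁻ (T? ∘ (λ x → memᵇ x S))
                        {xs = downFrom (suc (maxL S))} y∈dec))) t≤y

-- Empty cells of s read as 0 in map (fromMaybe 0) s, so the ≤ʳ invariant constrains only filled cells.
hatFold-≤ʳ : ∀ C c s L → c ≤ suc (length C) → length s ≡ c → AllPairs _>_ L
  → map (fromMaybe 0) s ≤ʳ C → (∀ t → count≥ t L ≤ freeRows t C s)
  → map (fromMaybe 0) (foldl (hatStep C c) s L) ≤ʳ C
hatFold-≤ʳ C c s [] c≤ len desc below room = below
hatFold-≤ʳ C c s (x ∷ L) c≤ len (x>L ∷ desc) below room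
  with hatStep-places C c s x c≤ len (≤-trans (s≤s z≤n) x-has-room)
  where
  x-has-room : suc (count≥ x L) ≤ freeRows x C s
  x-has-room = subst (_≤ freeRows x C s) (count≥-∷ x x L (T⇒true (≤⇒≤ᵇ (≤-refl {x})))) (room x)
... | r , placed , fits rewrite placed =
  hatFold-≤ʳ C c (setAt r x s) L c≤ (trans (length-setAt r x s) len) desc (setAt-≤ʳ {C} s r x below fits) room′
  where
  room′ : ∀ t → count≥ t L ≤ freeRows t C (setAt r x s)
  room′ t with t ≤ᵇ x in t≤x
  ... | true = ≤-pred (begin
    suc (count≥ t L)                  ≡⟨ count≥-∷ t x L t≤x ⟨
    count≥ t (x ∷ L)                  ≤⟨ room t ⟩
    freeRows t C s                    ≤⟨ freeRows-setAt t C s r x ⟩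
    suc (freeRows t C (setAt r x s))  ∎)
    where open ≤-Reasoning
  ... | false = subst (_≤ _) (sym (count≥-all-< L (All.map (λ y<x → <-trans y<x x<t) x>L))) z≤n
    where
    x<t : x < t
    x<t = ≰⇒> (λ t≤x′ → subst T t≤x (≤⇒≤ᵇ t≤x′))

hat-≤ʳ : ∀ S C → S ≤ʳ C → length S ≤ suc (length C) → hat S C ≤ʳ C
hat-≤ʳ S C S≤C short =
  hatFold-≤ʳ C (length S) (replicate (length S) nothing) (decreasing S) short (length-replicate (length S))
    (decreasing-descending S) (blank-≤ʳ (length S) C)
    (λ t → ≤-trans (count≥-decreasing t S) (freeRows-replicate t S C S≤C))

!?-conj : ∀ μ {k v} → conj μ !? k ≡ just v → v ≡ count≥ (suc k) μ
!?-conj μ e with !?-map⁻ _ (map suc (upTo (maxL μ))) e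
... | j , e′ , refl with !?-map⁻ suc (upTo (maxL μ)) e′
...   | j′ , e″ , refl = cong (λ j → count≥ (suc j) μ) (!?-applyUpTo id (maxL μ) e″)

staircase-linked : ∀ lam → (∀ k a b → lam !? k ≡ just a → lam !? suc k ≡ just b → b ≤ a)
  → Linked _>_ (zipWith _+_ lam (downFrom (length lam)))
staircase-linked [] dec = []
staircase-linked (x ∷ []) dec = [-]
staircase-linked (x ∷ y ∷ l) dec =
  +-mono-≤-< (dec 0 x y refl refl) ≤-refl ∷ staircase-linked (y ∷ l) (dec ∘ suc)

mu-descending : ∀ n lam → IsPartitionN n lam → AllPairs _>_ (mu n lam)
mu-descending n lam (len , dec , _) =
  subst (λ n → AllPairs _>_ (zipWith _+_ lam (downFrom n))) len
    (Linked⇒AllPairs (λ z>y y>x → <-trans y>x z>y) (staircase-linked lam dec))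

ent-column : ∀ T {j C} r → T !? j ≡ just C → ent T r j ≡ C !? r
ent-column T r e rewrite e = refl

module _ (μ : List ℕ) {n T} (inF : InF μ n T) {j A B} (A-at : T !? j ≡ just A) (B-at : T !? suc j ≡ just B) where

  adjacent-columns-≤ʳ : A ≤ʳ B
  adjacent-columns-≤ʳ {r} eA eB =
    rows-weakly-increasing r j _ _ (trans (ent-column T r A-at) eA) (trans (ent-column T r B-at) eB)
    where
    rows-weakly-increasing : ∀ r j x y → ent T r j ≡ just x → ent T r (suc j) ≡ just y → x ≤ y
    rows-weakly-increasing = proj₂ (proj₂ (proj₂ (proj₂ inF)))

  column-length : ∀ {k C} → T !? k ≡ just C → length C ≡ count≥ (suc k) μ
  column-length C-at = !?-conj μ (subst (λ lengths → lengths !? _ ≡ just _) (proj₁ inF) (!?-map⁺ length T C-at))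

  adjacent-columns-length : AllPairs _>_ μ → length A ≤ suc (length B)
  adjacent-columns-length desc =
    subst₂ (λ a b → a ≤ suc b) (sym (column-length A-at)) (sym (column-length B-at))
      (count≥-descending (suc j) μ desc)

lemma4p6 : (n : ℕ) → 2 ≤ n → (lam : List ℕ) → IsPartitionN n lam
    → (T : List (List ℕ)) → InF (mu n lam) n T
    → (i : ℕ) → 2 ≤ i → i ≤ length T
    → (Cprev Ci : List ℕ) (T' : List (List ℕ))
    → drop (i ∸ 2) T ≡ Cprev ∷ Ci ∷ T'
    → NonOverlapping (hat Cprev Ci) Ci
    → inv (hat Cprev Ci ∷ Ci ∷ T') ≡ inv (Ci ∷ T') + Nhat (hat Cprev Ci) Ci
lemma4p6 n _ lam partition T inF i _ _ Cprev Ci T' split nonOverlapping = begin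
  invCount (hat Cprev Ci) Ci + inv (Ci ∷ T')
    ≡⟨ cong (_+ inv (Ci ∷ T')) (PivotCount.invCount≡Nhat (hat Cprev Ci) Ci hat≤Ci nonOverlapping hat-short) ⟩
  Nhat (hat Cprev Ci) Ci + inv (Ci ∷ T')
    ≡⟨ +-comm (Nhat (hat Cprev Ci) Ci) (inv (Ci ∷ T')) ⟩
  inv (Ci ∷ T') + Nhat (hat Cprev Ci) Ci ∎
  where
  open ≡-Reasoning
  Cprev-at : T !? (i ∸ 2) ≡ just Cprev
  Cprev-at = drop-!? (i ∸ 2) T split
  Ci-at : T !? suc (i ∸ 2) ≡ just Ci
  Ci-at = drop-!? (suc (i ∸ 2)) T (drop-∷ (i ∸ 2) T split)
  Cprev-short : length Cprev ≤ suc (length Ci)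
  Cprev-short = adjacent-columns-length (mu n lam) inF Cprev-at Ci-at (mu-descending n lam partition)
  hat≤Ci : hat Cprev Ci ≤ʳ Ci
  hat≤Ci = hat-≤ʳ Cprev Ci (adjacent-columns-≤ʳ (mu n lam) inF Cprev-at Ci-at) Cprev-short
  hat-short : length (hat Cprev Ci) ≤ suc (length Ci)
  hat-short = subst (_≤ suc (length Ci)) (sym (length-hat Cprev Ci)) Cprev-short
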